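{- For a poset $D$, extensional K-model structures on $D$ correspond exactly to extensional reflexive object structures on $D$ in $\mathbf{ScottL}_!$: every order isomorphism $i_D:D\Rightarrow D\to D$ induces an isomorphism $\mathrm{abs}_D:\mathcal I(D)\to\mathcal I(D\Rightarrow D)$, $\mathrm{abs}_D(B)=\{(a,\alpha)\mid i_D(a,\alpha)\in B\}$, with inverse $\mathrm{app}_D(A)=\{i_D(a,\alpha)\mid(a,\alpha)\in A\}$; and conversely every isomorphism $\mathrm{abs}_D:(D\Rightarrow D)\to D$ in $\mathbf{ScottL}_!$ (i.e. Scott-continuous bijection between $\mathcal I(D\Rightarrow D)$ and $\mathcal I(D)$ with Scott-continuous inverse) arises in this way from a unique order isomorphism $i_D$.
   Context: For a poset $D$, $\mathcal A_f(D)$ is the set of finite antichains of $D$ ordered by $a\le b$ iff $\forall\alpha\in a\,\exists\beta\in b,\alpha\le\beta$, and $D\Rightarrow E:=\mathcal A_f(D)^{op}\times E$ with the componentwise order. $\mathcal I(D)$ is the complete lattice of initial segments (downward closed subsets) of $D$ ordered by inclusion. The category $\mathbf{ScottL}_!$ has posets as objects and, as morphisms $D\to E$, Scott-continuous functions $\mathcal I(D)\to\mathcal I(E)$; it is Cartesian closed with exponential $D\Rightarrow E$. An extensional K-model is a poset $D$ with an order isomorphism $i_D:\mathcal A_f(D)^{op}\times D\to D$. An extensional reflexive object is an object $D$ with an isomorphism $\mathrm{abs}_D:(D\Rightarrow D)\to D$ (and $\mathrm{app}_D=\mathrm{abs}_D^{ -1}$). -}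

module Defs where

open import Level using (Level; suc; _⊔_)
open import Data.Product using (Σ; ∃; _×_; _,_; proj₁; proj₂)
open import Data.List using (List; []; _∷_)
open import Data.List.Relation.Unary.All as All using (All; []; _∷_)
open import Data.List.Relation.Unary.Any as Any using (Any; here; there)
open import Data.List.Relation.Unary.AllPairs using (AllPairs)
open import Relation.Nullary using (¬_)
open import Relation.Binary using (Rel; Poset; IsPartialOrder; IsPreorder; IsEquivalence)
open import Relation.Binary.PropositionalEquality using (refl)
open import Relation.Binary.Morphism.Structures using (IsOrderIsomorphism)
open import Data.Product.Relation.Binary.Pointwise.NonDependent using (×-poset)
import Relation.Binary.Construct.Flip.EqAndOrd as Flip

-- A finite antichain is represented by a list of pairwise incomparable
-- elements; two antichains are identified when a ≤ b and b ≤ a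
-- (which for antichains means: same underlying set, up to ≈).

module _ {ℓ : Level} (D : Poset ℓ ℓ ℓ) where
  private module D = Poset D

  record Antichain : Set ℓ where
    constructor antichain
    field
      elems : List D.Carrier
      anti  : AllPairs (λ x y → ¬ (x D.≤ y) × ¬ (y D.≤ x)) elems

  open Antichain public

  _⊑_ : Rel Antichain ℓ
  a ⊑ b = All (λ α → Any (α D.≤_) (elems b)) (elems a)

  ⊑-refl : ∀ {a} → a ⊑ a
  ⊑-refl {a} = All.tabulate (λ x∈a → Any.map (λ { refl → D.refl }) x∈a)

  private
    any-trans : ∀ {α : D.Carrier} {bs cs : List D.Carrier} →
                Any (α D.≤_) bs → All (λ β → Any (β D.≤_) cs) bs → Any (α D.≤_) cs
    any-trans (here α≤β) (p ∷ _) = Any.map (λ β≤γ → D.trans α≤β β≤γ) p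
    any-trans (there q)  (_ ∷ ps) = any-trans q ps

  ⊑-trans : ∀ {a b c} → a ⊑ b → b ⊑ c → a ⊑ c
  ⊑-trans ab bc = All.map (λ q → any-trans q bc) ab

  _≋_ : Rel Antichain ℓ
  a ≋ b = (a ⊑ b) × (b ⊑ a)

  Af : Poset ℓ ℓ ℓ
  Af = record
    { Carrier = Antichain
    ; _≈_ = _≋_
    ; _≤_ = _⊑_
    ; isPartialOrder = record
      { isPreorder = record
        { isEquivalence = record
          { refl = λ {a} → ⊑-refl {a} , ⊑-refl {a}
          ; sym = λ { (p , q) → q , p }
          ; trans = λ {a} {b} {c} → λ { (p , q) (r , s) → ⊑-trans {a} {b} {c} p r , ⊑-trans {c} {b} {a} s q } }
        ; reflexive = proj₁
        ; trans = λ {a} {b} {c} → ⊑-trans {a} {b} {c} }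
      ; antisym = _,_ } }

_⇒_ : ∀ {ℓ} → Poset ℓ ℓ ℓ → Poset ℓ ℓ ℓ → Poset ℓ ℓ ℓ
D ⇒ E = ×-poset (Flip.poset (Af D)) E

module _ {ℓ : Level} (D : Poset ℓ ℓ ℓ) where
  private module D = Poset D

  record Init : Set (suc ℓ) where
    constructor initSeg
    field
      mem  : D.Carrier → Set ℓ
      down : ∀ {x y} → y D.≤ x → mem x → mem y

  open Init public

  ⋃ : {I : Set ℓ} → (I → Init) → Init
  ⋃ {I} F = initSeg (λ x → Σ I (λ i → mem (F i) x))
                    (λ y≤x → λ { (i , p) → i , down (F i) y≤x p })

  ↓ : D.Carrier → Init
  ↓ x = initSeg (λ y → y D.≤ x) (λ z≤y y≤x → D.trans z≤y y≤x)

_⊆_ : ∀ {ℓ} {D : Poset ℓ ℓ ℓ} → Init D → Init D → Set ℓ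
_⊆_ {D = D} S T = ∀ (x : Poset.Carrier D) → mem S x → mem T x

_≐_ : ∀ {ℓ} {D : Poset ℓ ℓ ℓ} → Init D → Init D → Set ℓ
S ≐ T = (S ⊆ T) × (T ⊆ S)

Directed : ∀ {ℓ} {D : Poset ℓ ℓ ℓ} {I : Set ℓ} → (I → Init D) → Set ℓ
Directed {I = I} F = I × (∀ i j → ∃ λ k → (F i ⊆ F k) × (F j ⊆ F k))

record ScottContinuous {ℓ} {D E : Poset ℓ ℓ ℓ} (f : Init D → Init E) : Set (suc ℓ) where
  field
    monotone : ∀ {S T} → S ⊆ T → f S ⊆ f T
    preserves-directed : ∀ {I : Set ℓ} (F : I → Init D) → Directed F →
                         f (⋃ D F) ≐ ⋃ E (λ i → f (F i))

record IsScottLIso {ℓ} {D E : Poset ℓ ℓ ℓ}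
                   (f : Init D → Init E) (g : Init E → Init D) : Set (suc ℓ) where
  field
    f-continuous : ScottContinuous f
    g-continuous : ScottContinuous g
    g∘f : ∀ A → g (f A) ≐ A
    f∘g : ∀ B → f (g B) ≐ B

IsKModelIso : ∀ {ℓ} (D : Poset ℓ ℓ ℓ) → (Poset.Carrier (D ⇒ D) → Poset.Carrier D) → Set ℓ
IsKModelIso D i = IsOrderIsomorphism (Poset._≈_ (D ⇒ D)) (Poset._≈_ D)
                                     (Poset._≤_ (D ⇒ D)) (Poset._≤_ D) i

module _ {ℓ : Level} (D : Poset ℓ ℓ ℓ) where
  private
    module D = Poset D
    module DD = Poset (D ⇒ D)

  preimageMap : (i : DD.Carrier → D.Carrier) → IsKModelIso D i → Init D → Init (D ⇒ D)
  preimageMap i iso B = initSeg (λ p → mem B (i p))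
                                (λ q≤p → down B (IsOrderIsomorphism.mono iso q≤p))

  imageMap : (i : DD.Carrier → D.Carrier) → IsKModelIso D i → Init (D ⇒ D) → Init D
  imageMap i iso A = initSeg (λ y → ∃ λ p → mem A p × (y D.≈ i p)) dn
    where
      open IsOrderIsomorphism iso
      dn : ∀ {x y} → y D.≤ x → (∃ λ p → mem A p × (x D.≈ i p)) → ∃ λ p → mem A p × (y D.≈ i p)
      dn {x} {y} y≤x (p , p∈A , x≈ip) =
        let (q , h) = surjective y
            iq≈y = h {q} (DD.Eq.refl {q})
            iq≤ip = D.trans (D.reflexive iq≈y) (D.trans y≤x (D.reflexive x≈ip))
        in q , down A (cancel {q} {p} iq≤ip) p∈A , D.Eq.sym iq≈y

-- An order isomorphism of the lattices of initial segments preserves arbitrary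
-- unions, and the principal segments ↓x are exactly the segments that lie in a
-- member of every union covering them.  Hence such an isomorphism abs, app maps
-- principal segments to principal ones, abs (↓ x) ≐ ↓ (i x), and i is an order
-- isomorphism with  x ∈ app B ⇔ i x ∈ B.  Conversely the pre-image/image maps of
-- an order isomorphism i are mutually inverse and trivially Scott-continuous.
module Submission where

open import Defs
open import Level using (Level)
open import Data.Product using (Σ; ∃; _×_; _,_; proj₁; proj₂)
open import Function.Consequences using (surjective⇒strictlySurjective; strictlySurjective⇒surjective)
open import Relation.Binary using (Poset)
open import Relation.Binary.Morphism.Structures using (IsOrderIsomorphism)

module _ {ℓ : Level} {D : Poset ℓ ℓ ℓ} where
  private module D = Poset D

  Monotone : ∀ {E : Poset ℓ ℓ ℓ} → (Init E → Init D) → Set (Level.suc ℓ)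
  Monotone f = ∀ {S T} → S ⊆ T → f S ⊆ f T

  ⊆-⋃-↓ : (A : Init D) → A ⊆ ⋃ D {Σ D.Carrier (mem A)} (λ z → ↓ D (proj₁ z))
  ⊆-⋃-↓ A x x∈A = (x , x∈A) , D.refl

  ↓-⊆ : ∀ {x} (B : Init D) → mem B x → ↓ D x ⊆ B
  ↓-⊆ B x∈B y y≤x = down B y≤x x∈B

module InitIso {ℓ : Level} {E D : Poset ℓ ℓ ℓ}
  (f : Init E → Init D) (g : Init D → Init E)
  (f-mono : Monotone f) (g-mono : Monotone g)
  (g∘f : ∀ A → g (f A) ≐ A) (f∘g : ∀ B → f (g B) ≐ B) where
  private
    module E = Poset E
    module D = Poset D

  f-⋃ : ∀ {I : Set ℓ} (F : I → Init E) → f (⋃ E F) ⊆ ⋃ D (λ k → f (F k))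
  f-⋃ F = λ y y∈f⋃ → proj₁ (f∘g U) y (f-mono ⋃⊆gU y y∈f⋃)
    where
      U : Init D
      U = ⋃ D (λ k → f (F k))
      ⋃⊆gU : ⋃ E F ⊆ g U
      ⋃⊆gU x (k , x∈Fk) = g-mono (λ y y∈ → k , y∈) x (proj₂ (g∘f (F k)) x x∈Fk)

  -- y ∈ f (g (↓ y)) puts y in f (↓ x) for some x ∈ g (↓ y); then g (↓ y) ⊆ ↓ x.
  g-↓-principal : ∀ y → Σ E.Carrier (λ x → g (↓ D y) ≐ ↓ E x)
  g-↓-principal y with f-⋃ (λ z → ↓ E (proj₁ z)) y
                         (f-mono (⊆-⋃-↓ (g (↓ D y))) y (proj₂ (f∘g (↓ D y)) y D.refl))
  ... | (x , x∈g↓y) , y∈f↓x =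
    x , (λ z z∈ → proj₁ (g∘f (↓ E x)) z (g-mono (↓-⊆ (f (↓ E x)) y∈f↓x) z z∈))
      , ↓-⊆ (g (↓ D y)) x∈g↓y

module KModelFromInitIso {ℓ : Level} {E D : Poset ℓ ℓ ℓ}
  (abs : Init E → Init D) (app : Init D → Init E)
  (abs-mono : Monotone abs) (app-mono : Monotone app)
  (app∘abs : ∀ A → app (abs A) ≐ A) (abs∘app : ∀ B → abs (app B) ≐ B) where
  private
    module E = Poset E
    module D = Poset D
    module AppAbs = InitIso app abs app-mono abs-mono abs∘app app∘abs
    module AbsApp = InitIso abs app abs-mono app-mono app∘abs abs∘app

  i : E.Carrier → D.Carrier
  i x = proj₁ (AppAbs.g-↓-principal x)

  abs-↓ : ∀ x → abs (↓ E x) ≐ ↓ D (i x)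
  abs-↓ x = proj₂ (AppAbs.g-↓-principal x)

  app-mem⇒ : ∀ {x} B → mem (app B) x → mem B (i x)
  app-mem⇒ {x} B x∈appB =
    proj₁ (abs∘app B) (i x)
      (abs-mono (↓-⊆ (app B) x∈appB) (i x) (proj₂ (abs-↓ x) (i x) D.refl))

  app-mem⇐ : ∀ {x} B → mem B (i x) → mem (app B) x
  app-mem⇐ {x} B ix∈B =
    app-mono (λ y y∈ → ↓-⊆ B ix∈B y (proj₁ (abs-↓ x) y y∈)) x
      (proj₂ (app∘abs (↓ E x)) x E.refl)

  i-mono : ∀ {x y} → x E.≤ y → i x D.≤ i y
  i-mono {x} {y} x≤y =
    app-mem⇒ (↓ D (i y)) (down (app (↓ D (i y))) x≤y (app-mem⇐ (↓ D (i y)) D.refl))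

  i-cancel : ∀ {x y} → i x D.≤ i y → x E.≤ y
  i-cancel {x} {y} ix≤iy =
    proj₁ (app∘abs (↓ E y)) x (app-mem⇐ (abs (↓ E y)) (proj₂ (abs-↓ y) (i x) ix≤iy))

  i-cong : ∀ {x y} → x E.≈ y → i x D.≈ i y
  i-cong x≈y = D.antisym (i-mono (E.reflexive x≈y)) (i-mono (E.reflexive (E.Eq.sym x≈y)))

  -- The inverse of i is read off from the principal segment app (↓ y).
  i-strictlySurjective : ∀ y → ∃ λ x → i x D.≈ y
  i-strictlySurjective y with AbsApp.g-↓-principal y
  ... | x , app↓y≐↓x =
    x , D.antisym (app-mem⇒ (↓ D y) (proj₂ app↓y≐↓x x E.refl))
                  (proj₁ (abs-↓ x) y
                     (abs-mono (proj₁ app↓y≐↓x) y (proj₂ (abs∘app (↓ D y)) y D.refl)))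

  i-isOrderIsomorphism : IsOrderIsomorphism E._≈_ D._≈_ E._≤_ D._≤_ i
  i-isOrderIsomorphism = record
    { isOrderMonomorphism = record
      { isOrderHomomorphism = record { cong = i-cong ; mono = i-mono }
      ; injective = λ ix≈iy → E.antisym (i-cancel (D.reflexive ix≈iy))
                                        (i-cancel (D.reflexive (D.Eq.sym ix≈iy)))
      ; cancel = i-cancel }
    ; surjective = strictlySurjective⇒surjective D.Eq.trans i-cong i-strictlySurjective }

  abs-mem⇒ : ∀ {y} A → mem (abs A) y → ∃ λ x → mem A x × (y D.≈ i x)
  abs-mem⇒ {y} A y∈absA with i-strictlySurjective y
  ... | x , ix≈y =
    x , proj₁ (app∘abs A) x (app-mem⇐ (abs A) (down (abs A) (D.reflexive ix≈y) y∈absA))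
      , D.Eq.sym ix≈y

  abs-mem⇐ : ∀ {y} A → (∃ λ x → mem A x × (y D.≈ i x)) → mem (abs A) y
  abs-mem⇐ A (x , x∈A , y≈ix) =
    down (abs A) (D.reflexive y≈ix) (app-mem⇒ (abs A) (proj₂ (app∘abs A) x x∈A))

  i-unique : ∀ (i′ : E.Carrier → D.Carrier) →
             (∀ B x → mem (app B) x → mem B (i′ x)) →
             (∀ B x → mem B (i′ x) → mem (app B) x) →
             ∀ x → i′ x D.≈ i x
  i-unique i′ app⇒ app⇐ x =
    D.antisym (app⇒ (↓ D (i x)) x (app-mem⇐ (↓ D (i x)) D.refl))
              (app-mem⇒ (↓ D (i′ x)) (app⇐ (↓ D (i′ x)) x D.refl))

module ScottLIsoFromKModel {ℓ : Level} (D : Poset ℓ ℓ ℓ)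
  (i : Poset.Carrier (D ⇒ D) → Poset.Carrier D) (iso : IsKModelIso D i) where
  private
    module D = Poset D
    module DD = Poset (D ⇒ D)
  open IsOrderIsomorphism iso using (cancel; surjective)

  private
    i-strictlySurjective : ∀ y → ∃ λ p → i p D.≈ y
    i-strictlySurjective =
      surjective⇒strictlySurjective D._≈_ (λ {p} → DD.Eq.refl {p}) surjective

  preimageMap-scottContinuous : ScottContinuous {D = D} {E = D ⇒ D} (preimageMap D i iso)
  preimageMap-scottContinuous = record
    { monotone = λ S⊆T p → S⊆T (i p)
    ; preserves-directed = λ _ _ → (λ _ p∈ → p∈) , (λ _ p∈ → p∈) }

  imageMap-scottContinuous : ScottContinuous {D = D ⇒ D} {E = D} (imageMap D i iso)
  imageMap-scottContinuous = record
    { monotone = λ { S⊆T y (p , p∈S , y≈ip) → p , S⊆T p p∈S , y≈ip }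
    ; preserves-directed = λ _ _ →
        (λ { y (p , (k , p∈Fk) , y≈ip) → k , p , p∈Fk , y≈ip })
      , (λ { y (k , p , p∈Fk , y≈ip) → p , (k , p∈Fk) , y≈ip }) }

  preimageMap-isScottLIso : IsScottLIso {D = D} {E = D ⇒ D} (preimageMap D i iso) (imageMap D i iso)
  preimageMap-isScottLIso = record
    { f-continuous = preimageMap-scottContinuous
    ; g-continuous = imageMap-scottContinuous
    ; g∘f = λ B → (λ { y (p , ip∈B , y≈ip) → down B (D.reflexive y≈ip) ip∈B })
                , (λ y y∈B → let (p , ip≈y) = i-strictlySurjective y
                             in p , down B (D.reflexive ip≈y) y∈B , D.Eq.sym ip≈y)
    ; f∘g = λ A → (λ { p (q , q∈A , ip≈iq) → down A (cancel (D.reflexive ip≈iq)) q∈A })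
                , (λ p p∈A → p , p∈A , D.Eq.refl) }

mainTheorem11 : ∀ {ℓ : Level} (D : Poset ℓ ℓ ℓ) →
    (∀ (i : Poset.Carrier (D ⇒ D) → Poset.Carrier D) (iso : IsKModelIso D i) →
       IsScottLIso {D = D} {E = D ⇒ D} (preimageMap D i iso) (imageMap D i iso))
    ×
    (∀ (abs : Init (D ⇒ D) → Init D) (app : Init D → Init (D ⇒ D)) →
       IsScottLIso {D = D ⇒ D} {E = D} abs app →
       Σ (Poset.Carrier (D ⇒ D) → Poset.Carrier D) (λ i → Σ (IsKModelIso D i) (λ iso →
         ((∀ B → app B ≐ preimageMap D i iso B) × (∀ A → abs A ≐ imageMap D i iso A))
         ×
         (∀ (i′ : Poset.Carrier (D ⇒ D) → Poset.Carrier D) (iso′ : IsKModelIso D i′) →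
            ((∀ B → app B ≐ preimageMap D i′ iso′ B) × (∀ A → abs A ≐ imageMap D i′ iso′ A)) →
            ∀ p → Poset._≈_ D (i′ p) (i p)))))
mainTheorem11 D = ScottLIsoFromKModel.preimageMap-isScottLIso D , λ abs app abs≅app →
  let open IsScottLIso abs≅app
      open KModelFromInitIso abs app (ScottContinuous.monotone f-continuous)
                             (ScottContinuous.monotone g-continuous) g∘f f∘g
  in  i , i-isOrderIsomorphism
    , ((λ B → (λ _ → app-mem⇒ B) , (λ _ → app-mem⇐ B))
      , (λ A → (λ _ → abs-mem⇒ A) , (λ _ → abs-mem⇐ A)))
    , (λ i′ _ (app≐ , _) → i-unique i′ (λ B → proj₁ (app≐ B)) (λ B → proj₂ (app≐ B)))
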